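{- Let $n\ge2$ and let $T=(V,E)$ be a rooted binary phylogenetic tree on $n$ leaves. Then the number of rooted binary phylogenetic trees $T'\neq T$ on the same leaves obtainable from $T$ by one SNPR (prune-and-regraft) operation is $$4n^2-14n+14-\sum_{e\in E}\delta(e).$$
   Context: A rooted binary phylogenetic tree on $n\ge2$ leaves is a directed tree with a root of in-degree 0 and out-degree 1 (its single edge being the root edge, included in $E$), $n$ leaves of in-degree 1 and out-degree 0 bijectively labelled by a fixed taxa set, and inner vertices of in-degree 1 and out-degree 2. Trees are equal if there is a leaf-label-preserving isomorphism. An edge $(a,b)$ is a descendant of $(c,d)$ if $d=a$ or there is a directed path from $d$ to $a$; $\delta(e)$ is the number of descendant edges of $e$ (not counting $e$). Pruning $e=(u,v)$ turns it into a half edge $(\cdot,v)$ and suppresses $u$; regrafting $(\cdot,v)$ to an edge $f$ subdivides $f$ with a new vertex $u'$ and adds $(u',v)$. The SNPR (prune-and-regraft) operation $(e,f)$, for $f\neq e$ not a descendant of $e$, prunes $e$ and regrafts it to $f$. -}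

module Defs where

open import Data.Nat using (ℕ; _∸_)
open import Data.Fin using (Fin)
open import Data.List using (List; []; _∷_; _++_; length; map)
open import Data.Nat.ListAction using (sum)
open import Data.List.Relation.Binary.Permutation.Propositional using (_↭_)
open import Data.List using (allFin)
open import Data.Product using (Σ; _×_; ∃; _,_)
open import Data.Sum using (_⊎_)

-- A rooted binary phylogenetic tree on taxa Fin n, represented by its
-- shape below the root edge: every `node` is an inner vertex (out-degree 2),
-- every `leaf i` a leaf labelled i.  The root (in-degree 0, out-degree 1)
-- and the root edge are implicit: the root edge enters the top vertex.
-- Child order in `node` carries no meaning; equality of trees is `_≅_`.
data Tree (n : ℕ) : Set where
  leaf : Fin n → Tree n
  node : Tree n → Tree n → Tree n

leaves : ∀ {n} → Tree n → List (Fin n)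
leaves (leaf i)   = i ∷ []
leaves (node a b) = leaves a ++ leaves b

IsPhylo : ∀ {n} → Tree n → Set
IsPhylo {n} T = leaves T ↭ allFin n

data _≅_ {n : ℕ} : Tree n → Tree n → Set where
  leaf≅  : ∀ i → leaf i ≅ leaf i
  straight : ∀ {a b c d} → a ≅ c → b ≅ d → node a b ≅ node c d
  crossed  : ∀ {a b c d} → a ≅ d → b ≅ c → node a b ≅ node c d

-- Edges of T: one edge entering each non-root vertex (the edge entering
-- the top vertex is the root edge).  We identify an edge with the subtree
-- hanging below it.
subtrees : ∀ {n} → Tree n → List (Tree n)
subtrees (leaf i)   = leaf i ∷ []
subtrees (node a b) = node a b ∷ (subtrees a ++ subtrees b)

-- δ(e) for the edge entering the top of t: the number of descendant edges,
-- i.e. the edges entering the proper descendants of that vertex.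
δ : ∀ {n} → Tree n → ℕ
δ t = length (subtrees t) ∸ 1

sumδ : ∀ {n} → Tree n → ℕ
sumδ T = sum (map δ (subtrees T))

-- Prune T S R : pruning a non-root edge e of T, whose hanging subtree is S,
-- (and suppressing the parent of e's head) leaves the tree R.
-- (Pruning the root edge admits no valid regraft edge f, so it is omitted.)
data Prune {n : ℕ} : Tree n → Tree n → Tree n → Set where
  here-l  : ∀ {s b} → Prune (node s b) s b
  here-r  : ∀ {a s} → Prune (node a s) s a
  there-l : ∀ {a b s a'} → Prune a s a' → Prune (node a b) s (node a' b)
  there-r : ∀ {a b s b'} → Prune b s b' → Prune (node a b) s (node a b')

-- Graft R S T' : regrafting the half edge with subtree S to an edge f of R
-- (f = the edge entering some vertex of R, the root edge included)
-- subdivides f and yields T'.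
data Graft {n : ℕ} : Tree n → Tree n → Tree n → Set where
  here    : ∀ {r s} → Graft r s (node r s)
  there-l : ∀ {a b s a'} → Graft a s a' → Graft (node a b) s (node a' b)
  there-r : ∀ {a b s b'} → Graft b s b' → Graft (node a b) s (node a b')

SNPR : ∀ {n} → Tree n → Tree n → Set
SNPR T T' = Σ _ λ S → Σ _ λ R → Prune T S R × Graft R S T'

module Submission where

-- Up to isomorphism, a tree obtained from T by one SNPR move and not
-- isomorphic to T is exactly one of
--   * node X B or node A Y, for X an SNPR neighbour of A or Y one of B;
--   * a tree whose root split cuts the leaf set of A but keeps B on one side: a subtree of A is
--     regrafted onto one of the 2b + 1 edges of B, or a subtree of A lying below a child of A is
--     regrafted onto the root edge, or B is regrafted onto an edge strictly inside a child of A;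
--   * the mirror image of the previous kind, with A and B exchanged.
-- The kinds are told apart by the root split, and trees of one kind by the pruned leaf set and the
-- regraft position.  If A and B have a and b inner vertices, the middle kind contributes
-- 2a(2b + 1) + 2(2a - 2) trees (none if A is a leaf), and solving the recursion gives
-- |N(T)| + Σ δ(e) = 4m² - 6m + 4 for a tree with m = n - 1 inner vertices.

open import Defs

module Neighbourhood where

  open import Data.Empty using (⊥; ⊥-elim)
  open import Data.Fin using (Fin)
  open import Data.List using (List; []; _∷_; _++_; length; map; concat)
  open import Data.List.Membership.Propositional using (_∈_; lose)
  open import Data.List.Membership.Propositional.Properties using (∈-map⁺; ∈-++⁺ˡ; ∈-++⁺ʳ; ∈-concat⁺′)
  open import Data.List.Properties using (length-++; length-map; map-++; length-tabulate)
  open import Data.List.Relation.Binary.Permutation.Propositional using (↭-sym; ↭⇒↭ₛ)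
  open import Data.List.Relation.Binary.Permutation.Propositional.Properties using (↭-length)
  open import Data.List.Relation.Binary.Permutation.Setoid.Properties using (Unique-resp-↭)
  open import Data.List.Relation.Binary.Pointwise as Pointwise using (Pointwise; []; _∷_; Pointwise-length)
  open import Data.List.Relation.Unary.All as All using (All; []; _∷_)
  import Data.List.Relation.Unary.All.Properties as Allₚ
  open import Data.List.Relation.Unary.AllPairs as AllPairs using (AllPairs; []; _∷_)
  import Data.List.Relation.Unary.AllPairs.Properties as AllPairsₚ
  open import Data.List.Relation.Unary.Any as Any using (Any; here; there)
  import Data.List.Relation.Unary.Any.Properties as Anyₚ
  open import Data.List.Relation.Unary.Unique.Propositional using (Unique)
  open import Data.List.Relation.Unary.Unique.Propositional.Properties using (allFin⁺)
  open import Data.Nat using (ℕ; suc; _+_; _*_; _∸_)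
  open import Data.Nat.ListAction using (sum)
  open import Data.Nat.ListAction.Properties using (sum-++)
  open import Data.Nat.Properties using (+-cancelʳ-≡; +-suc)
  open import Data.Nat.Tactic.RingSolver using (solve-∀)
  open import Data.Product using (Σ; ∃; _×_; _,_; proj₁; proj₂)
  open import Data.Sum as Sum using (_⊎_; inj₁; inj₂)
  open import Data.Unit using (⊤)
  open import Function using (_on_; _∘_)
  open import Relation.Binary.PropositionalEquality
    using (_≡_; refl; sym; trans; cong; cong₂; subst; setoid; module ≡-Reasoning)
  open import Relation.Nullary using (¬_)
  open ≡-Reasoning

  Across : {A : Set} → (A → A → Set) → List A → List A → Set
  Across R xs ys = All (λ x → All (R x) ys) xs

  all-map : {A B : Set} {P : B → Set} (f : A → B) → (∀ x → P (f x)) → (xs : List A) → All P (map f xs)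
  all-map f h xs = Allₚ.map⁺ (All.universal h xs)

  across-map : {A B C : Set} {R : C → C → Set} (f : A → C) (g : B → C) →
               (∀ x y → R (f x) (g y)) → (xs : List A) (ys : List B) → Across R (map f xs) (map g ys)
  across-map f g h xs ys = all-map f (λ x → all-map g (h x) ys) xs

  across : {A : Set} {P Q : A → Set} {R : A → A → Set} {xs ys : List A} →
           (∀ {x y} → P x → Q y → R x y) → All P xs → All Q ys → Across R xs ys
  across h ps qs = All.map (λ p → All.map (h p) qs) ps

  AllPairs-map-with : {A : Set} {P : A → Set} {R S : A → A → Set} {xs : List A} →
                      (∀ {x y} → P x → R x y → S x y) → All P xs → AllPairs R xs → AllPairs S xs
  AllPairs-map-with h []       []       = []
  AllPairs-map-with h (p ∷ ps) (r ∷ rs) = All.map (h p) r ∷ AllPairs-map-with h ps rs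

  Unique-++⁻ : {A : Set} (xs : List A) {ys : List A} → Unique (xs ++ ys) →
               Unique xs × Unique ys × (∀ {x} → x ∈ xs → x ∈ ys → ⊥)
  Unique-++⁻ []       u          = [] , u , λ ()
  Unique-++⁻ (x ∷ xs) (x∉ ∷ u) with Unique-++⁻ xs u
  ... | uxs , uys , d = Allₚ.++⁻ˡ xs x∉ ∷ uxs , uys , λ where
    (here refl) m → All.lookup (Allₚ.++⁻ʳ xs x∉) m refl
    (there m)  m′ → d m m′

  private variable
    n : ℕ
    x : Fin n
    Xs : List (Tree n)
    a b c d s t u a₁ a₂ A B R S T X Y : Tree n

  data _∈ₜ_ (x : Fin n) : Tree n → Set where
    leaf∈  : x ∈ₜ leaf x
    left∈  : x ∈ₜ a → x ∈ₜ node a b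
    right∈ : x ∈ₜ b → x ∈ₜ node a b

  _⊆ₜ_ : Tree n → Tree n → Set
  s ⊆ₜ t = ∀ {x} → x ∈ₜ s → x ∈ₜ t

  _⊈ₜ_ : Tree n → Tree n → Set
  s ⊈ₜ t = ∃ λ x → x ∈ₜ s × ¬ x ∈ₜ t

  Disjoint : Tree n → Tree n → Set
  Disjoint s t = ∀ {x} → x ∈ₜ s → x ∈ₜ t → ⊥

  UniqueLeaves : Tree n → Set
  UniqueLeaves (leaf _)   = ⊤
  UniqueLeaves (node a b) = UniqueLeaves a × UniqueLeaves b × Disjoint a b

  leafOf : Tree n → Fin n
  leafOf (leaf i)   = i
  leafOf (node a _) = leafOf a

  leafOf∈ : (t : Tree n) → leafOf t ∈ₜ t
  leafOf∈ (leaf i)   = leaf∈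
  leafOf∈ (node a _) = left∈ (leafOf∈ a)

  _≇_ : Tree n → Tree n → Set
  s ≇ t = ¬ (s ≅ t)

  ≅-refl : t ≅ t
  ≅-refl {t = leaf i}   = leaf≅ i
  ≅-refl {t = node a b} = straight ≅-refl ≅-refl

  ≅-sym : s ≅ t → t ≅ s
  ≅-sym (leaf≅ i)      = leaf≅ i
  ≅-sym (straight p q) = straight (≅-sym p) (≅-sym q)
  ≅-sym (crossed p q)  = crossed (≅-sym q) (≅-sym p)

  ≅-trans : s ≅ t → t ≅ u → s ≅ u
  ≅-trans (leaf≅ i)      q              = q
  ≅-trans (straight p q) (straight r s) = straight (≅-trans p r) (≅-trans q s)
  ≅-trans (straight p q) (crossed r s)  = crossed (≅-trans p r) (≅-trans q s)
  ≅-trans (crossed p q)  (straight r s) = crossed (≅-trans p s) (≅-trans q r)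
  ≅-trans (crossed p q)  (crossed r s)  = straight (≅-trans p s) (≅-trans q r)

  ∈-resp-≅ : s ≅ t → s ⊆ₜ t
  ∈-resp-≅ (leaf≅ i)      m          = m
  ∈-resp-≅ (straight p q) (left∈ m)  = left∈ (∈-resp-≅ p m)
  ∈-resp-≅ (straight p q) (right∈ m) = right∈ (∈-resp-≅ q m)
  ∈-resp-≅ (crossed p q)  (left∈ m)  = right∈ (∈-resp-≅ p m)
  ∈-resp-≅ (crossed p q)  (right∈ m) = left∈ (∈-resp-≅ q m)

  leaf-separates : x ∈ₜ s → ¬ x ∈ₜ t → s ≇ t
  leaf-separates m m∉ e = m∉ (∈-resp-≅ e m)

  leaf-separates′ : ¬ x ∈ₜ s → x ∈ₜ t → s ≇ t
  leaf-separates′ m∉ m e = m∉ (∈-resp-≅ (≅-sym e) m)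

  disjoint-sym : Disjoint s t → Disjoint t s
  disjoint-sym d mt ms = d ms mt

  disjoint⇒≇ : Disjoint s t → s ≇ t
  disjoint⇒≇ {s = s} d = leaf-separates (leafOf∈ s) (d (leafOf∈ s))

  prune-∈ˢ : Prune t S R → S ⊆ₜ t
  prune-∈ˢ here-l      m = left∈ m
  prune-∈ˢ here-r      m = right∈ m
  prune-∈ˢ (there-l p) m = left∈ (prune-∈ˢ p m)
  prune-∈ˢ (there-r p) m = right∈ (prune-∈ˢ p m)

  prune-∈ᴿ : Prune t S R → R ⊆ₜ t
  prune-∈ᴿ here-l      m          = right∈ m
  prune-∈ᴿ here-r      m          = left∈ m
  prune-∈ᴿ (there-l p) (left∈ m)  = left∈ (prune-∈ᴿ p m)
  prune-∈ᴿ (there-l p) (right∈ m) = right∈ m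
  prune-∈ᴿ (there-r p) (left∈ m)  = left∈ m
  prune-∈ᴿ (there-r p) (right∈ m) = right∈ (prune-∈ᴿ p m)

  prune-∈⁻ : Prune t S R → x ∈ₜ t → x ∈ₜ S ⊎ x ∈ₜ R
  prune-∈⁻ here-l      (left∈ m)  = inj₁ m
  prune-∈⁻ here-l      (right∈ m) = inj₂ m
  prune-∈⁻ here-r      (left∈ m)  = inj₂ m
  prune-∈⁻ here-r      (right∈ m) = inj₁ m
  prune-∈⁻ (there-l p) (left∈ m)  = Sum.map₂ left∈ (prune-∈⁻ p m)
  prune-∈⁻ (there-l p) (right∈ m) = inj₂ (right∈ m)
  prune-∈⁻ (there-r p) (left∈ m)  = inj₂ (left∈ m)
  prune-∈⁻ (there-r p) (right∈ m) = Sum.map₂ right∈ (prune-∈⁻ p m)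

  prune-disjoint : UniqueLeaves t → Prune t S R → Disjoint S R
  prune-disjoint (_ , _ , dab) here-l = dab
  prune-disjoint (_ , _ , dab) here-r = disjoint-sym dab
  prune-disjoint (ua , _ , dab) (there-l p) = λ where
    mS (left∈ mR)  → prune-disjoint ua p mS mR
    mS (right∈ mb) → dab (prune-∈ˢ p mS) mb
  prune-disjoint (_ , ub , dab) (there-r p) = λ where
    mS (left∈ ma)  → dab ma (prune-∈ˢ p mS)
    mS (right∈ mR) → prune-disjoint ub p mS mR

  graft-∈ᴿ : Graft R S t → R ⊆ₜ t
  graft-∈ᴿ here        m          = left∈ m
  graft-∈ᴿ (there-l g) (left∈ m)  = left∈ (graft-∈ᴿ g m)
  graft-∈ᴿ (there-l g) (right∈ m) = right∈ m
  graft-∈ᴿ (there-r g) (left∈ m)  = left∈ m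
  graft-∈ᴿ (there-r g) (right∈ m) = right∈ (graft-∈ᴿ g m)

  graft-∈ˢ : Graft R S t → S ⊆ₜ t
  graft-∈ˢ here        m = right∈ m
  graft-∈ˢ (there-l g) m = left∈ (graft-∈ˢ g m)
  graft-∈ˢ (there-r g) m = right∈ (graft-∈ˢ g m)

  graft-∈⁻ : Graft R S t → x ∈ₜ t → x ∈ₜ R ⊎ x ∈ₜ S
  graft-∈⁻ here        (left∈ m)  = inj₁ m
  graft-∈⁻ here        (right∈ m) = inj₂ m
  graft-∈⁻ (there-l g) (left∈ m)  = Sum.map₁ left∈ (graft-∈⁻ g m)
  graft-∈⁻ (there-l g) (right∈ m) = inj₁ (right∈ m)
  graft-∈⁻ (there-r g) (left∈ m)  = inj₁ (left∈ m)
  graft-∈⁻ (there-r g) (right∈ m) = Sum.map₁ right∈ (graft-∈⁻ g m)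

  snpr-∈⁻ : SNPR t u → u ⊆ₜ t
  snpr-∈⁻ (_ , _ , p , g) m = Sum.[ prune-∈ᴿ p , prune-∈ˢ p ] (graft-∈⁻ g m)

  -- Root splits

  Intersects : Tree n → Tree n → Set
  Intersects s t = ∃ λ x → x ∈ₜ s × x ∈ₜ t

  data OneSideAvoids (X : Tree n) : Tree n → Set where
    leftAvoids  : Disjoint a X → OneSideAvoids X (node a b)
    rightAvoids : Disjoint b X → OneSideAvoids X (node a b)

  data BothSidesMeet (X : Tree n) : Tree n → Set where
    bothMeet : Intersects a X → Intersects b X → BothSidesMeet X (node a b)

  intersects-resp-≅ : s ≅ t → Intersects s X → Intersects t X
  intersects-resp-≅ e (x , m , mX) = x , ∈-resp-≅ e m , mX

  disjoint-resp-≅ : s ≅ t → Disjoint s X → Disjoint t X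
  disjoint-resp-≅ e d m = d (∈-resp-≅ (≅-sym e) m)

  intersects⇒¬disjoint : Intersects s X → ¬ Disjoint s X
  intersects⇒¬disjoint (_ , m , mX) d = d m mX

  oneSideAvoids-resp-≅ : t ≅ u → OneSideAvoids X t → OneSideAvoids X u
  oneSideAvoids-resp-≅ (straight p q) (leftAvoids d)  = leftAvoids (disjoint-resp-≅ p d)
  oneSideAvoids-resp-≅ (straight p q) (rightAvoids d) = rightAvoids (disjoint-resp-≅ q d)
  oneSideAvoids-resp-≅ (crossed p q)  (leftAvoids d)  = rightAvoids (disjoint-resp-≅ p d)
  oneSideAvoids-resp-≅ (crossed p q)  (rightAvoids d) = leftAvoids (disjoint-resp-≅ q d)

  bothSidesMeet-resp-≅ : t ≅ u → BothSidesMeet X t → BothSidesMeet X u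
  bothSidesMeet-resp-≅ (straight p q) (bothMeet i j) = bothMeet (intersects-resp-≅ p i) (intersects-resp-≅ q j)
  bothSidesMeet-resp-≅ (crossed p q)  (bothMeet i j) = bothMeet (intersects-resp-≅ q j) (intersects-resp-≅ p i)

  oneSideAvoids⇒≇bothSidesMeet : OneSideAvoids X t → BothSidesMeet X u → t ≇ u
  oneSideAvoids⇒≇bothSidesMeet o m e with oneSideAvoids-resp-≅ e o | m
  ... | leftAvoids d  | bothMeet i _ = intersects⇒¬disjoint i d
  ... | rightAvoids d | bothMeet _ j = intersects⇒¬disjoint j d

  Pruning : Tree n → Set
  Pruning {n} t = Σ (Tree n) λ S → Σ (Tree n) λ R → Prune t S R

  pruned rest : Pruning {n} t → Tree n
  pruned (S , _ , _) = S
  rest   (_ , R , _) = R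

  pruneLeft : ∀ b → Pruning a → Pruning (node a b)
  pruneLeft b (S , R , p) = S , node R b , there-l p

  pruneRight : ∀ a → Pruning b → Pruning (node a b)
  pruneRight a (S , R , p) = S , node a R , there-r p

  mutual
    prunings : (t : Tree n) → List (Pruning t)
    prunings (leaf _)   = []
    prunings (node a b) = (a , b , here-l) ∷ (b , a , here-r) ∷ deepPrunings a b

    deepPrunings : (a b : Tree n) → List (Pruning (node a b))
    deepPrunings a b = map (pruneLeft b) (prunings a) ++ map (pruneRight a) (prunings b)

  Grafting : Tree n → Tree n → Set
  Grafting {n} R S = Σ (Tree n) λ t → Graft R S t

  graftLeft : ∀ b → Grafting a S → Grafting (node a b) S
  graftLeft b (t , g) = node t b , there-l g

  graftRight : ∀ a → Grafting b S → Grafting (node a b) S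
  graftRight a (t , g) = node a t , there-r g

  mutual
    graftings : (R S : Tree n) → List (Grafting R S)
    graftings R S = (node R S , here) ∷ innerGraftings R S

    innerGraftings : (R S : Tree n) → List (Grafting R S)
    innerGraftings (leaf _)   S = []
    innerGraftings (node a b) S = map (graftLeft b) (graftings a S) ++ map (graftRight a) (graftings b S)

  ∈-prunings : (p : Prune t S R) → (S , R , p) ∈ prunings t
  ∈-prunings here-l = here refl
  ∈-prunings here-r = there (here refl)
  ∈-prunings {t = node a b} (there-l p) = there (there (∈-++⁺ˡ (∈-map⁺ (pruneLeft b) (∈-prunings p))))
  ∈-prunings {t = node a b} (there-r p) =
    there (there (∈-++⁺ʳ (map (pruneLeft b) (prunings a)) (∈-map⁺ (pruneRight a) (∈-prunings p))))

  mutual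
    ∈-graftings : (g : Graft R S t) → (t , g) ∈ graftings R S
    ∈-graftings here        = here refl
    ∈-graftings (there-l g) = there (∈-innerGraftingsˡ g)
    ∈-graftings (there-r g) = there (∈-innerGraftingsʳ g)

    ∈-innerGraftingsˡ : (g : Graft a S t) → (node t b , there-l g) ∈ innerGraftings (node a b) S
    ∈-innerGraftingsˡ {b = b} g = ∈-++⁺ˡ (∈-map⁺ (graftLeft b) (∈-graftings g))

    ∈-innerGraftingsʳ : (g : Graft b S t) → (node a t , there-r g) ∈ innerGraftings (node a b) S
    ∈-innerGraftingsʳ {b = b} {S = S} {a = a} g =
      ∈-++⁺ʳ (map (graftLeft b) (graftings a S)) (∈-map⁺ (graftRight a) (∈-graftings g))

  tree⊈pruned : UniqueLeaves t → Prune t S R → t ⊈ₜ S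
  tree⊈pruned {R = R} u p = _ , prune-∈ᴿ p (leafOf∈ R) , λ m → prune-disjoint u p m (leafOf∈ R)

  prunings-distinct : UniqueLeaves t → AllPairs (_⊈ₜ_ on pruned) (prunings t)
  prunings-distinct {t = leaf _} _ = []
  prunings-distinct {t = node a b} (ua , ub , dab) =
    (a⊈b ∷ Allₚ.++⁺ (all-map (pruneLeft b) (λ (_ , _ , p) → tree⊈pruned ua p) (prunings a))
                   (all-map (pruneRight a) a⊈right (prunings b)))
    ∷ Allₚ.++⁺ (all-map (pruneLeft b) b⊈left (prunings a))
              (all-map (pruneRight a) (λ (_ , _ , q) → tree⊈pruned ub q) (prunings b))
    ∷ AllPairsₚ.++⁺ (AllPairsₚ.map⁺ (prunings-distinct ua)) (AllPairsₚ.map⁺ (prunings-distinct ub))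
                   (across-map (pruneLeft b) (pruneRight a) left⊈right (prunings a) (prunings b))
    where
    a⊈b : a ⊈ₜ b
    a⊈b = _ , leafOf∈ a , dab (leafOf∈ a)
    a⊈right : (q : Pruning b) → a ⊈ₜ pruned q
    a⊈right (_ , _ , q) = _ , leafOf∈ a , λ m → dab (leafOf∈ a) (prune-∈ˢ q m)
    b⊈left : (p : Pruning a) → b ⊈ₜ pruned p
    b⊈left (_ , _ , p) = _ , leafOf∈ b , λ m → dab (prune-∈ˢ p m) (leafOf∈ b)
    left⊈right : (p : Pruning a) (q : Pruning b) → pruned p ⊈ₜ pruned q
    left⊈right (S , _ , p) (_ , _ , q) = _ , leafOf∈ S , λ m → dab (prune-∈ˢ p (leafOf∈ S)) (prune-∈ˢ q m)

  graftings-distinct : UniqueLeaves R → Disjoint R S → AllPairs (_≇_ on proj₁) (graftings R S)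
  graftings-distinct {R = leaf _} _ _ = [] ∷ []
  graftings-distinct {R = node a b} {S = S} (ua , ub , dab) dRS =
    Allₚ.++⁺ (all-map (graftLeft b) root≇left (graftings a S)) (all-map (graftRight a) root≇right (graftings b S))
    ∷ AllPairsₚ.++⁺ (AllPairsₚ.map⁺ {f = graftLeft b} (AllPairs.map (λ {g} {h} → left-injective g h) (graftings-distinct ua daS)))
                    (AllPairsₚ.map⁺ {f = graftRight a} (AllPairs.map (λ {g} {h} → right-injective g h) (graftings-distinct ub dbS)))
                    (across-map (graftLeft b) (graftRight a) left≇right (graftings a S) (graftings b S))
    where
    daS : Disjoint a S
    daS m = dRS (left∈ m)
    dbS : Disjoint b S
    dbS m = dRS (right∈ m)
    root≇left : (g : Grafting a S) → node (node a b) S ≇ node (proj₁ g) b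
    root≇left _ (straight _ S≅b) = disjoint⇒≇ (disjoint-sym dbS) S≅b
    root≇left _ (crossed ab≅b _) = leaf-separates (left∈ (leafOf∈ a)) (dab (leafOf∈ a)) ab≅b
    root≇right : (h : Grafting b S) → node (node a b) S ≇ node a (proj₁ h)
    root≇right _ (straight ab≅a _) = leaf-separates (right∈ (leafOf∈ b)) (λ m → dab m (leafOf∈ b)) ab≅a
    root≇right _ (crossed _ S≅a) = disjoint⇒≇ (disjoint-sym daS) S≅a
    left-injective : (g h : Grafting a S) → proj₁ g ≇ proj₁ h → node (proj₁ g) b ≇ node (proj₁ h) b
    left-injective _       _ ne (straight e _) = ne e
    left-injective (_ , g) _ _  (crossed e _)  = leaf-separates (graft-∈ᴿ g (leafOf∈ a)) (dab (leafOf∈ a)) e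
    right-injective : (g h : Grafting b S) → proj₁ g ≇ proj₁ h → node a (proj₁ g) ≇ node a (proj₁ h)
    right-injective _ _       ne (straight _ e) = ne e
    right-injective _ (_ , h) _  (crossed e _)  = leaf-separates′ (λ m → dab m (leafOf∈ b)) (graft-∈ᴿ h (leafOf∈ b)) e
    left≇right : (g : Grafting a S) (h : Grafting b S) → node (proj₁ g) b ≇ node a (proj₁ h)
    left≇right _ (_ , h) (straight _ e) = leaf-separates′ (λ m → dbS m (leafOf∈ S)) (graft-∈ˢ h (leafOf∈ S)) e
    left≇right (_ , g) (_ , h) (crossed e _) with graft-∈⁻ h (∈-resp-≅ e (graft-∈ᴿ g (leafOf∈ a)))
    ... | inj₁ m = dab (leafOf∈ a) m
    ... | inj₂ m = daS (leafOf∈ a) m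

  -- Moves that split the left child

  regraftsInto : (B : Tree n) → Pruning {n} A → List (Tree n)
  regraftsInto B (S , R , _) = map (λ g → node R (proj₁ g)) (graftings B S)

  crossGrafts : Tree n → Tree n → List (Tree n)
  crossGrafts A B = concat (map (regraftsInto B) (prunings A))

  rootGrafts : (a₁ a₂ B : Tree n) → List (Tree n)
  rootGrafts a₁ a₂ B = map (λ p → node (node (rest p) B) (pruned p)) (deepPrunings a₁ a₂)

  sinkGrafts : (a₁ a₂ B : Tree n) → List (Tree n)
  sinkGrafts a₁ a₂ B =
    map (λ g → node (proj₁ g) a₂) (innerGraftings a₁ B) ++ map (λ g → node a₁ (proj₁ g)) (innerGraftings a₂ B)

  splitMoves : Tree n → Tree n → List (Tree n)
  splitMoves (leaf _)     B = []
  splitMoves (node a₁ a₂) B = crossGrafts (node a₁ a₂) B ++ rootGrafts a₁ a₂ B ++ sinkGrafts a₁ a₂ B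

  ∈-crossGrafts : Prune A S R → Graft B S u → node R u ∈ crossGrafts A B
  ∈-crossGrafts {B = B} p g =
    ∈-concat⁺′ (∈-map⁺ (λ h → node _ (proj₁ h)) (∈-graftings g)) (∈-map⁺ (regraftsInto B) (∈-prunings p))

  ∈-rootGraftsˡ : Prune a₁ S R → node (node (node R a₂) B) S ∈ rootGrafts a₁ a₂ B
  ∈-rootGraftsˡ {a₂ = a₂} p = ∈-map⁺ _ (∈-++⁺ˡ (∈-map⁺ (pruneLeft a₂) (∈-prunings p)))

  ∈-rootGraftsʳ : Prune a₂ S R → node (node (node a₁ R) B) S ∈ rootGrafts a₁ a₂ B
  ∈-rootGraftsʳ {a₂ = a₂} {a₁ = a₁} p =
    ∈-map⁺ _ (∈-++⁺ʳ (map (pruneLeft a₂) (prunings a₁)) (∈-map⁺ (pruneRight a₁) (∈-prunings p)))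

  ∈-sinkGraftsˡ : {g : Graft a₁ B u} → (u , g) ∈ innerGraftings a₁ B → node u a₂ ∈ sinkGrafts a₁ a₂ B
  ∈-sinkGraftsˡ m = ∈-++⁺ˡ (∈-map⁺ _ m)

  ∈-sinkGraftsʳ : {g : Graft a₂ B u} → (u , g) ∈ innerGraftings a₂ B → node a₁ u ∈ sinkGrafts a₁ a₂ B
  ∈-sinkGraftsʳ {B = B} {a₁ = a₁} m = ∈-++⁺ʳ (map (λ g → node (proj₁ g) _) (innerGraftings a₁ B)) (∈-map⁺ _ m)

  prune-keepsChild : Prune (node a b) S R → a ⊆ₜ R ⊎ b ⊆ₜ R
  prune-keepsChild here-l      = inj₂ λ m → m
  prune-keepsChild here-r      = inj₁ λ m → m
  prune-keepsChild (there-l _) = inj₂ right∈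
  prune-keepsChild (there-r _) = inj₁ left∈

  graft-oneSideAvoids : Disjoint R X → Graft R S u → OneSideAvoids X u
  graft-oneSideAvoids d here        = leftAvoids d
  graft-oneSideAvoids d (there-l _) = rightAvoids λ m → d (right∈ m)
  graft-oneSideAvoids d (there-r _) = leftAvoids λ m → d (left∈ m)

  graft-intersects : (g : Grafting R S) → Intersects (proj₁ g) S
  graft-intersects {S = S} (_ , g) = _ , graft-∈ˢ g (leafOf∈ S) , leafOf∈ S

  innerGraftings-bothSidesMeet : R ⊆ₜ X → All (BothSidesMeet X ∘ proj₁) (innerGraftings R S)
  innerGraftings-bothSidesMeet {R = leaf _} _ = []
  innerGraftings-bothSidesMeet {R = node c d} {X = X} {S = S} R⊆X =
    Allₚ.++⁺ (all-map (graftLeft d) (λ (_ , g) → bothMeet (meets (graft-∈ᴿ g (leafOf∈ c)) (left∈ (leafOf∈ c)))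
                                                     (meets (leafOf∈ d) (right∈ (leafOf∈ d))))
                      (graftings c S))
             (all-map (graftRight c) (λ (_ , g) → bothMeet (meets (leafOf∈ c) (left∈ (leafOf∈ c)))
                                                      (meets (graft-∈ᴿ g (leafOf∈ d)) (right∈ (leafOf∈ d))))
                      (graftings d S))
    where
    meets : x ∈ₜ t → x ∈ₜ node c d → Intersects t X
    meets m m′ = _ , m , R⊆X m′

  Splits : Tree n → Tree n → Tree n → Set
  Splits A B t = OneSideAvoids B t × BothSidesMeet A t

  data CrossGraft (A B : Tree n) : Tree n → Set where
    crossGraft : Prune A S R → Graft B S u → CrossGraft A B (node R u)

  -- The pruned subtree S lies strictly below a child.
  data RootGraft (a₁ a₂ B : Tree n) : Tree n → Set where
    rootGraft : Prune (node a₁ a₂) S R → a₁ ⊈ₜ S → a₂ ⊈ₜ S → RootGraft a₁ a₂ B (node (node R B) S)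

  data SinkGraft (a₁ a₂ B : Tree n) : Tree n → Set where
    sinkLeft  : Intersects u B → BothSidesMeet (node a₁ a₂) u → SinkGraft a₁ a₂ B (node u a₂)
    sinkRight : Intersects u B → BothSidesMeet (node a₁ a₂) u → SinkGraft a₁ a₂ B (node a₁ u)

  crossGrafts-described : All (CrossGraft A B) (crossGrafts A B)
  crossGrafts-described {A = A} {B = B} =
    Allₚ.concat⁺ (all-map _ (λ (S , _ , p) → all-map _ (λ (_ , g) → crossGraft p g) (graftings B S)) (prunings A))

  rootGrafts-described : UniqueLeaves (node a₁ a₂) → All (RootGraft a₁ a₂ B) (rootGrafts a₁ a₂ B)
  rootGrafts-described {a₁ = a₁} {a₂ = a₂} (u₁ , u₂ , d₁₂) =
    Allₚ.map⁺ (Allₚ.++⁺ (all-map (pruneLeft a₂) fromLeft (prunings a₁)) (all-map (pruneRight a₁) fromRight (prunings a₂)))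
    where
    fromLeft : (q : Pruning a₁) → RootGraft a₁ a₂ _ _
    fromLeft (_ , _ , q) = rootGraft (there-l q) (tree⊈pruned u₁ q)
                                     (_ , leafOf∈ a₂ , λ m → d₁₂ (prune-∈ˢ q m) (leafOf∈ a₂))
    fromRight : (q : Pruning a₂) → RootGraft a₁ a₂ _ _
    fromRight (_ , _ , q) = rootGraft (there-r q) (_ , leafOf∈ a₁ , λ m → d₁₂ (leafOf∈ a₁) (prune-∈ˢ q m))
                                      (tree⊈pruned u₂ q)

  sinkGrafts-described : All (SinkGraft a₁ a₂ B) (sinkGrafts a₁ a₂ B)
  sinkGrafts-described =
    Allₚ.++⁺ (Allₚ.map⁺ (All.map (λ {g} → sinkLeft (graft-intersects g)) (innerGraftings-bothSidesMeet left∈)))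
             (Allₚ.map⁺ (All.map (λ {g} → sinkRight (graft-intersects g)) (innerGraftings-bothSidesMeet right∈)))

  crossGraft-snpr : CrossGraft A B t → SNPR (node A B) t
  crossGraft-snpr (crossGraft p g) = _ , _ , there-l p , there-r g

  rootGraft-snpr : RootGraft a₁ a₂ B t → SNPR (node (node a₁ a₂) B) t
  rootGraft-snpr (rootGraft p _ _) = _ , _ , there-l p , here

  sinkGrafts-snpr : All (SNPR (node (node a₁ a₂) B)) (sinkGrafts a₁ a₂ B)
  sinkGrafts-snpr {a₁ = a₁} {a₂ = a₂} {B = B} =
    Allₚ.++⁺ (all-map _ (λ (_ , g) → _ , _ , here-r , there-l g) (innerGraftings a₁ B))
             (all-map _ (λ (_ , g) → _ , _ , here-r , there-r g) (innerGraftings a₂ B))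

  bothSidesMeet⇒intersects : BothSidesMeet X t → Intersects t X
  bothSidesMeet⇒intersects (bothMeet (x , m , mX) _) = x , left∈ m , mX

  crossGraft-splits : Disjoint A B → CrossGraft A B t → Splits A B t
  crossGraft-splits dAB (crossGraft {S = S} {R = R} p g) =
    leftAvoids (dAB ∘ prune-∈ᴿ p) ,
    bothMeet (_ , leafOf∈ R , prune-∈ᴿ p (leafOf∈ R)) (_ , graft-∈ˢ g (leafOf∈ S) , prune-∈ˢ p (leafOf∈ S))

  rootGraft-splits : Disjoint (node a₁ a₂) B → RootGraft a₁ a₂ B t → Splits (node a₁ a₂) B t
  rootGraft-splits dAB (rootGraft {S = S} {R = R} p _ _) =
    rightAvoids (dAB ∘ prune-∈ˢ p) ,
    bothMeet (_ , left∈ (leafOf∈ R) , prune-∈ᴿ p (leafOf∈ R)) (_ , leafOf∈ S , prune-∈ˢ p (leafOf∈ S))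

  sinkGraft-splits : Disjoint (node a₁ a₂) B → SinkGraft a₁ a₂ B t → Splits (node a₁ a₂) B t
  sinkGraft-splits {a₂ = a₂} dAB (sinkLeft _ m) =
    rightAvoids (dAB ∘ right∈) , bothMeet (bothSidesMeet⇒intersects m) (_ , leafOf∈ a₂ , right∈ (leafOf∈ a₂))
  sinkGraft-splits {a₁ = a₁} dAB (sinkRight _ m) =
    leftAvoids (dAB ∘ left∈) , bothMeet (_ , leafOf∈ a₁ , left∈ (leafOf∈ a₁)) (bothSidesMeet⇒intersects m)

  crossGrafts-distinct : UniqueLeaves A → UniqueLeaves B → Disjoint A B → AllPairs _≇_ (crossGrafts A B)
  crossGrafts-distinct {A = A} {B = B} uA uB dAB =
    AllPairsₚ.concat⁺ (all-map (regraftsInto B) sameRest (prunings A))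
                      (AllPairsₚ.map⁺ (AllPairs.map (λ {p} {q} → differentRests p q) (prunings-distinct uA)))
    where
    B∉ : R ⊆ₜ A → ¬ leafOf B ∈ₜ R
    B∉ R⊆A m = dAB (R⊆A m) (leafOf∈ B)
    sameRest : (p : Pruning A) → AllPairs _≇_ (regraftsInto B p)
    sameRest (S , R , p) =
      AllPairsₚ.map⁺ (AllPairs.map (λ {g} {h} → regraft-injective g h) (graftings-distinct uB (λ mB mS → dAB (prune-∈ˢ p mS) mB)))
      where
      regraft-injective : (g h : Grafting B S) → proj₁ g ≇ proj₁ h → node R (proj₁ g) ≇ node R (proj₁ h)
      regraft-injective _ _        ne (straight _ e) = ne e
      regraft-injective _ (_ , h) _  (crossed e _)  = leaf-separates′ (B∉ (prune-∈ᴿ p)) (graft-∈ᴿ h (leafOf∈ B)) e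
    differentRests : (p q : Pruning A) → pruned p ⊈ₜ pruned q → Across _≇_ (regraftsInto B p) (regraftsInto B q)
    differentRests (S , R , p) (S′ , R′ , q) (_ , mS , m∉S′) = across-map _ _ regrafts≇ (graftings B S) (graftings B S′)
      where
      regrafts≇ : (g : Grafting B S) (h : Grafting B S′) → node R (proj₁ g) ≇ node R′ (proj₁ h)
      regrafts≇ _ _ (straight e _) with prune-∈⁻ q (prune-∈ˢ p mS)
      ... | inj₁ mS′ = m∉S′ mS′
      ... | inj₂ mR′ = leaf-separates′ (prune-disjoint uA p mS) mR′ e
      regrafts≇ _ (_ , h) (crossed e _) = leaf-separates′ (B∉ (prune-∈ᴿ p)) (graft-∈ᴿ h (leafOf∈ B)) e

  rootGrafts-distinct : UniqueLeaves (node a₁ a₂) → Disjoint (node a₁ a₂) B → AllPairs _≇_ (rootGrafts a₁ a₂ B)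
  rootGrafts-distinct {B = B} uA dAB =
    AllPairsₚ.map⁺ (AllPairs.map (λ {p} {q} → rootGrafts≇ p q) (AllPairs.tail (AllPairs.tail (prunings-distinct uA))))
    where
    rootGrafts≇ : (p q : Pruning _) → pruned p ⊈ₜ pruned q →
                  node (node (rest p) B) (pruned p) ≇ node (node (rest q) B) (pruned q)
    rootGrafts≇ _ _ (_ , mS , m∉S′) (straight _ e) = leaf-separates mS m∉S′ e
    rootGrafts≇ _ (_ , _ , q) _ (crossed e _) =
      leaf-separates (right∈ (leafOf∈ B)) (λ m → dAB (prune-∈ˢ q m) (leafOf∈ B)) e

  sinkGrafts-distinct : UniqueLeaves (node a₁ a₂) → Disjoint (node a₁ a₂) B → AllPairs _≇_ (sinkGrafts a₁ a₂ B)
  sinkGrafts-distinct {a₁ = a₁} {a₂ = a₂} {B = B} (u₁ , u₂ , d₁₂) dAB =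
    AllPairsₚ.++⁺ (AllPairsₚ.map⁺ (AllPairs.map (λ {g} {h} → left-injective g h)
                                               (AllPairs.tail (graftings-distinct u₁ (dAB ∘ left∈)))))
                  (AllPairsₚ.map⁺ (AllPairs.map (λ {g} {h} → right-injective g h)
                                               (AllPairs.tail (graftings-distinct u₂ (dAB ∘ right∈)))))
                  (across-map _ _ left≇right (innerGraftings a₁ B) (innerGraftings a₂ B))
    where
    B∉ : R ⊆ₜ node a₁ a₂ → ¬ leafOf B ∈ₜ R
    B∉ R⊆A m = dAB (R⊆A m) (leafOf∈ B)
    left-injective : (g h : Grafting a₁ B) → proj₁ g ≇ proj₁ h → node (proj₁ g) a₂ ≇ node (proj₁ h) a₂
    left-injective _       _ ne (straight e _) = ne e
    left-injective (_ , g) _ _  (crossed e _)  = leaf-separates (graft-∈ˢ g (leafOf∈ B)) (B∉ right∈) e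
    right-injective : (g h : Grafting a₂ B) → proj₁ g ≇ proj₁ h → node a₁ (proj₁ g) ≇ node a₁ (proj₁ h)
    right-injective _ _       ne (straight _ e) = ne e
    right-injective _ (_ , h) _  (crossed e _)  = leaf-separates′ (B∉ left∈) (graft-∈ˢ h (leafOf∈ B)) e
    left≇right : (g : Grafting a₁ B) (h : Grafting a₂ B) → node (proj₁ g) a₂ ≇ node a₁ (proj₁ h)
    left≇right (_ , g) _ (straight e _) = leaf-separates (graft-∈ˢ g (leafOf∈ B)) (B∉ left∈) e
    left≇right _       _ (crossed _ e)  = disjoint⇒≇ (disjoint-sym d₁₂) e

  crossGraft≇rootGraft : Disjoint (node a₁ a₂) B → CrossGraft (node a₁ a₂) B t → RootGraft a₁ a₂ B u → t ≇ u
  crossGraft≇rootGraft {B = B} dAB (crossGraft p _) (rootGraft _ _ _) (straight e _) =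
    leaf-separates′ (λ m → dAB (prune-∈ᴿ p m) (leafOf∈ B)) (right∈ (leafOf∈ B)) e
  crossGraft≇rootGraft _ (crossGraft p _) (rootGraft _ (_ , m₁ , m₁∉) (_ , m₂ , m₂∉)) (crossed e _)
    with prune-keepsChild p
  ... | inj₁ a₁⊆R = leaf-separates (a₁⊆R m₁) m₁∉ e
  ... | inj₂ a₂⊆R = leaf-separates (a₂⊆R m₂) m₂∉ e

  crossGraft≇sinkGraft : Disjoint (node a₁ a₂) B → CrossGraft (node a₁ a₂) B t → SinkGraft a₁ a₂ B u → t ≇ u
  crossGraft≇sinkGraft dAB (crossGraft p g) (sinkLeft (_ , mv , mB) _) (straight e _) =
    leaf-separates′ (λ m → dAB (prune-∈ᴿ p m) mB) mv e
  crossGraft≇sinkGraft dAB (crossGraft p g) (sinkLeft _ meets) (crossed _ e) =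
    oneSideAvoids⇒≇bothSidesMeet (graft-oneSideAvoids (disjoint-sym dAB) g) meets e
  crossGraft≇sinkGraft dAB (crossGraft p g) (sinkRight _ meets) (straight _ e) =
    oneSideAvoids⇒≇bothSidesMeet (graft-oneSideAvoids (disjoint-sym dAB) g) meets e
  crossGraft≇sinkGraft dAB (crossGraft p g) (sinkRight (_ , mv , mB) _) (crossed e _) =
    leaf-separates′ (λ m → dAB (prune-∈ᴿ p m) mB) mv e

  rootGraft≇sinkGraft : Disjoint (node a₁ a₂) B → RootGraft a₁ a₂ B t → SinkGraft a₁ a₂ B u → t ≇ u
  rootGraft≇sinkGraft _ (rootGraft _ _ (_ , m , m∉)) (sinkLeft _ _) (straight _ e) = leaf-separates′ m∉ m e
  rootGraft≇sinkGraft {B = B} dAB (rootGraft _ _ _) (sinkLeft _ _) (crossed e _) =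
    leaf-separates (right∈ (leafOf∈ B)) (λ m → dAB (right∈ m) (leafOf∈ B)) e
  rootGraft≇sinkGraft {B = B} dAB (rootGraft _ _ _) (sinkRight _ _) (straight e _) =
    leaf-separates (right∈ (leafOf∈ B)) (λ m → dAB (left∈ m) (leafOf∈ B)) e
  rootGraft≇sinkGraft _ (rootGraft _ (_ , m , m∉) _) (sinkRight _ _) (crossed _ e) = leaf-separates′ m∉ m e

  splitMoves-sound : UniqueLeaves A → Disjoint A B → All (λ t → SNPR (node A B) t × Splits A B t) (splitMoves A B)
  splitMoves-sound {A = leaf _}     _  _   = []
  splitMoves-sound {A = node _ _} uA dAB =
    Allₚ.++⁺ (All.map (λ c → crossGraft-snpr c , crossGraft-splits dAB c) crossGrafts-described)
    (Allₚ.++⁺ (All.map (λ r → rootGraft-snpr r , rootGraft-splits dAB r) (rootGrafts-described uA))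
              (All.zip (sinkGrafts-snpr , All.map (sinkGraft-splits dAB) sinkGrafts-described)))

  splitMoves-distinct : UniqueLeaves A → UniqueLeaves B → Disjoint A B → AllPairs _≇_ (splitMoves A B)
  splitMoves-distinct {A = leaf _}     _  _  _   = []
  splitMoves-distinct {A = node _ _} uA uB dAB =
    AllPairsₚ.++⁺ (crossGrafts-distinct uA uB dAB)
      (AllPairsₚ.++⁺ (rootGrafts-distinct uA dAB) (sinkGrafts-distinct uA dAB)
                     (across (rootGraft≇sinkGraft dAB) (rootGrafts-described uA) sinkGrafts-described))
      (across (λ c → Sum.[ crossGraft≇rootGraft dAB c , crossGraft≇sinkGraft dAB c ])
              crossGrafts-described
              (Allₚ.++⁺ (All.map inj₁ (rootGrafts-described uA)) (All.map inj₂ sinkGrafts-described)))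

  flipRoot : Tree n → Tree n
  flipRoot (leaf i)   = leaf i
  flipRoot (node a b) = node b a

  flipLeft : Tree n → Tree n
  flipLeft (leaf i)            = leaf i
  flipLeft (node (leaf i) c)   = node (leaf i) c
  flipLeft (node (node a b) c) = node (node b a) c

  flipRoot≅ : (t : Tree n) → flipRoot t ≅ t
  flipRoot≅ (leaf i)   = leaf≅ i
  flipRoot≅ (node a b) = crossed ≅-refl ≅-refl

  flipLeft≅ : (t : Tree n) → flipLeft t ≅ t
  flipLeft≅ (leaf i)            = leaf≅ i
  flipLeft≅ (node (leaf i) c)   = ≅-refl
  flipLeft≅ (node (node a b) c) = straight (crossed ≅-refl ≅-refl) ≅-refl

  -- The trees of splitMoves B A, flipped so that they are literal SNPR results of node A B.
  mirroredSplitMoves : Tree n → Tree n → List (Tree n)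
  mirroredSplitMoves A (leaf _)     = []
  mirroredSplitMoves A (node b₁ b₂) =
    map flipRoot (crossGrafts (node b₁ b₂) A) ++ map flipLeft (rootGrafts b₁ b₂ A) ++ sinkGrafts b₁ b₂ A

  mirroredSplitMoves≅splitMoves : Pointwise _≅_ (mirroredSplitMoves A B) (splitMoves B A)
  mirroredSplitMoves≅splitMoves {B = leaf _}       = []
  mirroredSplitMoves≅splitMoves {A = A} {B = node b₁ b₂} =
    Pointwise.++⁺ (flipped flipRoot≅ (crossGrafts (node b₁ b₂) A))
      (Pointwise.++⁺ (flipped flipLeft≅ (rootGrafts b₁ b₂ A)) (Pointwise.refl ≅-refl))
    where
    flipped : {f : Tree n → Tree n} → (∀ t → f t ≅ t) → ∀ ts → Pointwise _≅_ (map f ts) ts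
    flipped f≅ []       = []
    flipped f≅ (t ∷ ts) = f≅ t ∷ flipped f≅ ts

  All-resp-pointwise≅ : {P : Tree n → Set} → (∀ {s t} → s ≅ t → P t → P s) →
                        {ss ts : List (Tree n)} → Pointwise _≅_ ss ts → All P ts → All P ss
  All-resp-pointwise≅ resp []       []       = []
  All-resp-pointwise≅ resp (e ∷ es) (p ∷ ps) = resp e p ∷ All-resp-pointwise≅ resp es ps

  distinct-resp-pointwise≅ : {ss ts : List (Tree n)} → Pointwise _≅_ ss ts → AllPairs _≇_ ts → AllPairs _≇_ ss
  distinct-resp-pointwise≅ []       []         = []
  distinct-resp-pointwise≅ (e ∷ es) (ne ∷ nes) =
    All-resp-pointwise≅ (λ e′ ne′ e″ → ne′ (≅-trans e″ e′)) es (All.map (λ ne′ e″ → ne′ (≅-trans (≅-sym e) e″)) ne)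
    ∷ distinct-resp-pointwise≅ es nes

  splits-resp-≅ : s ≅ t → Splits A B t → Splits A B s
  splits-resp-≅ e (o , m) = oneSideAvoids-resp-≅ (≅-sym e) o , bothSidesMeet-resp-≅ (≅-sym e) m

  mirroredSplitMoves-snpr : All (SNPR (node A B)) (mirroredSplitMoves A B)
  mirroredSplitMoves-snpr {B = leaf _}       = []
  mirroredSplitMoves-snpr {A = A} {B = node b₁ b₂} =
    Allₚ.++⁺ (Allₚ.map⁺ (All.map flippedCross crossGrafts-described))
    (Allₚ.++⁺ (Allₚ.map⁺ (all-map _ (λ (_ , _ , p) → _ , _ , there-r p , here) (deepPrunings b₁ b₂)))
              (Allₚ.++⁺ (all-map _ (λ (_ , g) → _ , _ , here-l , there-l g) (innerGraftings b₁ A))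
                        (all-map _ (λ (_ , g) → _ , _ , here-l , there-r g) (innerGraftings b₂ A))))
    where
    flippedCross : CrossGraft (node b₁ b₂) A t → SNPR (node A (node b₁ b₂)) (flipRoot t)
    flippedCross (crossGraft p g) = _ , _ , there-r p , there-l g

  mirroredSplitMoves-sound : UniqueLeaves B → Disjoint A B →
                             All (λ t → SNPR (node A B) t × Splits B A t) (mirroredSplitMoves A B)
  mirroredSplitMoves-sound {B = B} {A = A} uB dAB =
    All.zip (mirroredSplitMoves-snpr ,
             All-resp-pointwise≅ splits-resp-≅ (mirroredSplitMoves≅splitMoves {A = A} {B = B})
                                 (All.map proj₂ (splitMoves-sound uB (disjoint-sym dAB))))

  mirroredSplitMoves-distinct : UniqueLeaves A → UniqueLeaves B → Disjoint A B →
                                AllPairs _≇_ (mirroredSplitMoves A B)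
  mirroredSplitMoves-distinct {A = A} {B = B} uA uB dAB =
    distinct-resp-pointwise≅ (mirroredSplitMoves≅splitMoves {A = A} {B = B}) (splitMoves-distinct uB uA (disjoint-sym dAB))

  neighbours : Tree n → List (Tree n)
  neighbours (leaf _)   = []
  neighbours (node A B) =
    map (λ X → node X B) (neighbours A) ++ map (node A) (neighbours B) ++ splitMoves A B ++ mirroredSplitMoves A B

  data InLeftChild (A B : Tree n) : Tree n → Set where
    inLeftChild : SNPR A X → X ≇ A → InLeftChild A B (node X B)

  data InRightChild (A B : Tree n) : Tree n → Set where
    inRightChild : SNPR B X → X ≇ B → InRightChild A B (node A X)

  KeepsApart : Tree n → Tree n → Tree n → Set
  KeepsApart A B t = OneSideAvoids A t × OneSideAvoids B t

  module _ (dAB : Disjoint A B) where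

    root-keepsApart : KeepsApart A B (node A B)
    root-keepsApart = rightAvoids (disjoint-sym dAB) , leftAvoids dAB

    inLeftChild-keepsApart : InLeftChild A B t → KeepsApart A B t
    inLeftChild-keepsApart (inLeftChild snpr _) = rightAvoids (disjoint-sym dAB) , leftAvoids (dAB ∘ snpr-∈⁻ snpr)

    inRightChild-keepsApart : InRightChild A B t → KeepsApart A B t
    inRightChild-keepsApart (inRightChild snpr _) = rightAvoids (disjoint-sym dAB ∘ snpr-∈⁻ snpr) , leftAvoids dAB

    inLeftChild-sound : InLeftChild A B t → SNPR (node A B) t × t ≇ node A B
    inLeftChild-sound (inLeftChild snpr@(_ , _ , p , g) X≇A) = (_ , _ , there-l p , there-l g) , ≇root
      where
      ≇root : node _ B ≇ node A B
      ≇root (straight e _) = X≇A e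
      ≇root (crossed e _)  = disjoint⇒≇ (dAB ∘ snpr-∈⁻ snpr) e

    inRightChild-sound : InRightChild A B t → SNPR (node A B) t × t ≇ node A B
    inRightChild-sound (inRightChild (_ , _ , p , g) X≇B) = (_ , _ , there-r p , there-r g) , ≇root
      where
      ≇root : node A _ ≇ node A B
      ≇root (straight _ e) = X≇B e
      ≇root (crossed e _)  = disjoint⇒≇ dAB e

    inLeftChild≇inRightChild : InLeftChild A B t → InRightChild A B u → t ≇ u
    inLeftChild≇inRightChild (inLeftChild _ X≇A) (inRightChild _ _) (straight e _) = X≇A e
    inLeftChild≇inRightChild (inLeftChild snpr _) (inRightChild snpr′ _) (crossed e _) =
      disjoint⇒≇ (λ mX mY → dAB (snpr-∈⁻ snpr mX) (snpr-∈⁻ snpr′ mY)) e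

  keepsApart≇splits : KeepsApart A B t → Splits A B u → t ≇ u
  keepsApart≇splits (o , _) (_ , m) = oneSideAvoids⇒≇bothSidesMeet o m

  keepsApart≇mirrored : KeepsApart A B t → Splits B A u → t ≇ u
  keepsApart≇mirrored (_ , o) (_ , m) = oneSideAvoids⇒≇bothSidesMeet o m

  splits≇mirrored : Splits A B t → Splits B A u → t ≇ u
  splits≇mirrored (o , _) (_ , m) = oneSideAvoids⇒≇bothSidesMeet o m

  inLeftChildren : All (λ X → SNPR A X × X ≇ A) Xs → All (InLeftChild A B) (map (λ X → node X B) Xs)
  inLeftChildren = Allₚ.map⁺ ∘ All.map (λ (snpr , ne) → inLeftChild snpr ne)

  inRightChildren : All (λ X → SNPR B X × X ≇ B) Xs → All (InRightChild A B) (map (node A) Xs)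
  inRightChildren = Allₚ.map⁺ ∘ All.map (λ (snpr , ne) → inRightChild snpr ne)

  neighbours-sound : UniqueLeaves T → All (λ T′ → SNPR T T′ × T′ ≇ T) (neighbours T)
  neighbours-sound {T = leaf _} _ = []
  neighbours-sound {T = node A B} (uA , uB , dAB) =
    Allₚ.++⁺ (All.map (inLeftChild-sound dAB) (inLeftChildren (neighbours-sound uA)))
    (Allₚ.++⁺ (All.map (inRightChild-sound dAB) (inRightChildren (neighbours-sound uB)))
    (Allₚ.++⁺ (All.map (λ (snpr , split) → snpr , λ e → keepsApart≇splits (root-keepsApart dAB) split (≅-sym e))
                       (splitMoves-sound uA dAB))
              (All.map (λ (snpr , split) → snpr , λ e → keepsApart≇mirrored (root-keepsApart dAB) split (≅-sym e))
                       (mirroredSplitMoves-sound uB dAB))))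

  keepsApart≇moved : KeepsApart A B t → Splits A B u ⊎ Splits B A u → t ≇ u
  keepsApart≇moved k = Sum.[ keepsApart≇splits k , keepsApart≇mirrored k ]

  neighbours-distinct : UniqueLeaves T → AllPairs _≇_ (neighbours T)
  neighbours-distinct {T = leaf _} _ = []
  neighbours-distinct {T = node A B} (uA , uB , dAB) =
    AllPairsₚ.++⁺ (AllPairsₚ.map⁺ (AllPairs-map-with left-injective (neighbours-sound uA) (neighbours-distinct uA)))
    (AllPairsₚ.++⁺ (AllPairsₚ.map⁺ (AllPairs-map-with right-injective (neighbours-sound uB) (neighbours-distinct uB)))
      (AllPairsₚ.++⁺ (splitMoves-distinct uA uB dAB) (mirroredSplitMoves-distinct uA uB dAB)
                     (across splits≇mirrored splits mirrored))
      (across (λ r → keepsApart≇moved (inRightChild-keepsApart dAB r)) rights moved))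
    (across (λ l → Sum.[ inLeftChild≇inRightChild dAB l , keepsApart≇moved (inLeftChild-keepsApart dAB l) ])
            lefts (Allₚ.++⁺ (All.map inj₁ rights) (All.map inj₂ moved)))
    where
    lefts = inLeftChildren (neighbours-sound uA)
    rights = inRightChildren (neighbours-sound uB)
    splits = All.map proj₂ (splitMoves-sound uA dAB)
    mirrored = All.map proj₂ (mirroredSplitMoves-sound uB dAB)
    moved = Allₚ.++⁺ (All.map inj₁ splits) (All.map inj₂ mirrored)
    left-injective : SNPR A X × X ≇ A → X ≇ Y → node X B ≇ node Y B
    left-injective _           X≇Y (straight e _) = X≇Y e
    left-injective (snpr , _)  _   (crossed e _)  = disjoint⇒≇ (dAB ∘ snpr-∈⁻ snpr) e
    right-injective : SNPR B X × X ≇ B → X ≇ Y → node A X ≇ node A Y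
    right-injective _          X≇Y (straight _ e) = X≇Y e
    right-injective (snpr , _) _   (crossed _ e)  = disjoint⇒≇ (disjoint-sym dAB ∘ snpr-∈⁻ snpr) e

  -- The trees are explicit here because the lists they index reduce, which defeats unification.
  module _ (a₁ a₂ B : Tree n) where

    ∈-splitMoves-cross : t ∈ crossGrafts (node a₁ a₂) B → t ∈ splitMoves (node a₁ a₂) B
    ∈-splitMoves-cross = ∈-++⁺ˡ

    ∈-splitMoves-root : t ∈ rootGrafts a₁ a₂ B → t ∈ splitMoves (node a₁ a₂) B
    ∈-splitMoves-root = ∈-++⁺ʳ (crossGrafts _ B) ∘ ∈-++⁺ˡ

    ∈-splitMoves-sink : t ∈ sinkGrafts a₁ a₂ B → t ∈ splitMoves (node a₁ a₂) B
    ∈-splitMoves-sink = ∈-++⁺ʳ (crossGrafts _ B) ∘ ∈-++⁺ʳ (rootGrafts a₁ a₂ B)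

    ∈-mirrored-cross : t ∈ crossGrafts (node a₁ a₂) B → flipRoot t ∈ mirroredSplitMoves B (node a₁ a₂)
    ∈-mirrored-cross = ∈-++⁺ˡ ∘ ∈-map⁺ flipRoot

    ∈-mirrored-root : t ∈ rootGrafts a₁ a₂ B → flipLeft t ∈ mirroredSplitMoves B (node a₁ a₂)
    ∈-mirrored-root = ∈-++⁺ʳ (map flipRoot (crossGrafts _ B)) ∘ ∈-++⁺ˡ ∘ ∈-map⁺ flipLeft

    ∈-mirrored-sink : t ∈ sinkGrafts a₁ a₂ B → t ∈ mirroredSplitMoves B (node a₁ a₂)
    ∈-mirrored-sink = ∈-++⁺ʳ (map flipRoot (crossGrafts _ B)) ∘ ∈-++⁺ʳ (map flipLeft (rootGrafts a₁ a₂ B))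

  module _ (A B : Tree n) where

    covered-by-split : t ∈ splitMoves A B → u ≅ t → Any (u ≅_) (neighbours (node A B))
    covered-by-split =
      lose ∘ ∈-++⁺ʳ (map (λ X → node X B) (neighbours A)) ∘ ∈-++⁺ʳ (map (node A) (neighbours B)) ∘ ∈-++⁺ˡ

    covered-by-mirrored : t ∈ mirroredSplitMoves A B → u ≅ t → Any (u ≅_) (neighbours (node A B))
    covered-by-mirrored =
      lose ∘ ∈-++⁺ʳ (map (λ X → node X B) (neighbours A)) ∘ ∈-++⁺ʳ (map (node A) (neighbours B))
           ∘ ∈-++⁺ʳ (splitMoves A B)

  cover-moveRightChild : Graft A B u → u ≇ node A B → Any (u ≅_) (neighbours (node A B))
  cover-moveRightChild here ne = ⊥-elim (ne ≅-refl)
  cover-moveRightChild {A = node a₁ a₂} {B = B} (there-l here) _ =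
    covered-by-split _ B (∈-splitMoves-cross a₁ a₂ B (∈-crossGrafts here-l here))
                     (crossed (crossed ≅-refl ≅-refl) ≅-refl)
  cover-moveRightChild {A = node a₁ a₂} {B = B} (there-l (there-l g)) _ =
    covered-by-split _ B (∈-splitMoves-sink a₁ a₂ B (∈-sinkGraftsˡ (∈-innerGraftingsˡ g))) ≅-refl
  cover-moveRightChild {A = node a₁ a₂} {B = B} (there-l (there-r g)) _ =
    covered-by-split _ B (∈-splitMoves-sink a₁ a₂ B (∈-sinkGraftsˡ (∈-innerGraftingsʳ g))) ≅-refl
  cover-moveRightChild {A = node a₁ a₂} {B = B} (there-r here) _ =
    covered-by-split _ B (∈-splitMoves-cross a₁ a₂ B (∈-crossGrafts here-r here))
                     (straight ≅-refl (crossed ≅-refl ≅-refl))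
  cover-moveRightChild {A = node a₁ a₂} {B = B} (there-r (there-l g)) _ =
    covered-by-split _ B (∈-splitMoves-sink a₁ a₂ B (∈-sinkGraftsʳ (∈-innerGraftingsˡ g))) ≅-refl
  cover-moveRightChild {A = node a₁ a₂} {B = B} (there-r (there-r g)) _ =
    covered-by-split _ B (∈-splitMoves-sink a₁ a₂ B (∈-sinkGraftsʳ (∈-innerGraftingsʳ g))) ≅-refl

  cover-moveLeftChild : Graft B A u → u ≇ node A B → Any (u ≅_) (neighbours (node A B))
  cover-moveLeftChild here ne = ⊥-elim (ne (crossed ≅-refl ≅-refl))
  cover-moveLeftChild {B = node b₁ b₂} {A = A} (there-l here) _ =
    covered-by-mirrored A _ (∈-mirrored-cross b₁ b₂ A (∈-crossGrafts here-l here))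
                        (straight (crossed ≅-refl ≅-refl) ≅-refl)
  cover-moveLeftChild {B = node b₁ b₂} {A = A} (there-l (there-l g)) _ =
    covered-by-mirrored A _ (∈-mirrored-sink b₁ b₂ A (∈-sinkGraftsˡ (∈-innerGraftingsˡ g))) ≅-refl
  cover-moveLeftChild {B = node b₁ b₂} {A = A} (there-l (there-r g)) _ =
    covered-by-mirrored A _ (∈-mirrored-sink b₁ b₂ A (∈-sinkGraftsˡ (∈-innerGraftingsʳ g))) ≅-refl
  cover-moveLeftChild {B = node b₁ b₂} {A = A} (there-r here) _ =
    covered-by-mirrored A _ (∈-mirrored-cross b₁ b₂ A (∈-crossGrafts here-r here))
                        (crossed ≅-refl (crossed ≅-refl ≅-refl))
  cover-moveLeftChild {B = node b₁ b₂} {A = A} (there-r (there-l g)) _ =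
    covered-by-mirrored A _ (∈-mirrored-sink b₁ b₂ A (∈-sinkGraftsʳ (∈-innerGraftingsˡ g))) ≅-refl
  cover-moveLeftChild {B = node b₁ b₂} {A = A} (there-r (there-r g)) _ =
    covered-by-mirrored A _ (∈-mirrored-sink b₁ b₂ A (∈-sinkGraftsʳ (∈-innerGraftingsʳ g))) ≅-refl

  Complete : Tree n → Set
  Complete T = ∀ T′ → SNPR T T′ → T′ ≇ T → Any (T′ ≅_) (neighbours T)

  cover-pruneWithinLeft : Complete A → Prune A S R → Graft (node R B) S u → u ≇ node A B →
                          Any (u ≅_) (neighbours (node A B))
  cover-pruneWithinLeft {A = node a₁ a₂} {B = B} _ here-l here _ =
    covered-by-split _ B (∈-splitMoves-cross a₁ a₂ B (∈-crossGrafts here-r here))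
                     (crossed (crossed ≅-refl ≅-refl) ≅-refl)
  cover-pruneWithinLeft {A = node a₁ a₂} {B = B} _ here-r here _ =
    covered-by-split _ B (∈-splitMoves-cross a₁ a₂ B (∈-crossGrafts here-l here))
                     (crossed (crossed ≅-refl ≅-refl) ≅-refl)
  cover-pruneWithinLeft {A = node a₁ a₂} {B = B} _ (there-l p) here _ =
    covered-by-split _ B (∈-splitMoves-root a₁ a₂ B (∈-rootGraftsˡ p)) ≅-refl
  cover-pruneWithinLeft {A = node a₁ a₂} {B = B} _ (there-r p) here _ =
    covered-by-split _ B (∈-splitMoves-root a₁ a₂ B (∈-rootGraftsʳ p)) ≅-refl
  cover-pruneWithinLeft complete p (there-l g) ne =
    Anyₚ.++⁺ˡ (Anyₚ.map⁺ (Any.map (λ e → straight e ≅-refl)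
                                  (complete _ (_ , _ , p , g) (λ e → ne (straight e ≅-refl)))))
  cover-pruneWithinLeft {A = node a₁ a₂} {B = B} _ p (there-r g) _ =
    covered-by-split _ B (∈-splitMoves-cross a₁ a₂ B (∈-crossGrafts p g)) ≅-refl

  cover-pruneWithinRight : Complete B → Prune B S R → Graft (node A R) S u → u ≇ node A B →
                           Any (u ≅_) (neighbours (node A B))
  cover-pruneWithinRight {B = node b₁ b₂} {A = A} _ here-l here _ =
    covered-by-mirrored A _ (∈-mirrored-cross b₁ b₂ A (∈-crossGrafts here-r here)) ≅-refl
  cover-pruneWithinRight {B = node b₁ b₂} {A = A} _ here-r here _ =
    covered-by-mirrored A _ (∈-mirrored-cross b₁ b₂ A (∈-crossGrafts here-l here)) ≅-refl
  cover-pruneWithinRight {B = node b₁ b₂} {A = A} _ (there-l p) here _ =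
    covered-by-mirrored A _ (∈-mirrored-root b₁ b₂ A (∈-rootGraftsˡ p)) ≅-refl
  cover-pruneWithinRight {B = node b₁ b₂} {A = A} _ (there-r p) here _ =
    covered-by-mirrored A _ (∈-mirrored-root b₁ b₂ A (∈-rootGraftsʳ p)) ≅-refl
  cover-pruneWithinRight {B = node b₁ b₂} {A = A} _ p (there-l g) _ =
    covered-by-mirrored A _ (∈-mirrored-cross b₁ b₂ A (∈-crossGrafts p g)) ≅-refl
  cover-pruneWithinRight {B = B} {A = A} complete p (there-r g) ne =
    Anyₚ.++⁺ʳ (map (λ X → node X B) (neighbours A))
      (Anyₚ.++⁺ˡ (Anyₚ.map⁺ (Any.map (λ e → straight ≅-refl e)
                                     (complete _ (_ , _ , p , g) (λ e → ne (straight ≅-refl e))))))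

  neighbours-complete : (T : Tree n) → Complete T
  neighbours-complete (leaf _)   _ (_ , _ , () , _)
  neighbours-complete (node A B) _ (_ , _ , here-l , g)      ne = cover-moveLeftChild g ne
  neighbours-complete (node A B) _ (_ , _ , here-r , g)      ne = cover-moveRightChild g ne
  neighbours-complete (node A B) _ (_ , _ , there-l p , g)   ne = cover-pruneWithinLeft (neighbours-complete A) p g ne
  neighbours-complete (node A B) _ (_ , _ , there-r p , g)   ne = cover-pruneWithinRight (neighbours-complete B) p g ne

  -- Counting

  #inner : Tree n → ℕ
  #inner (leaf _)   = 0
  #inner (node a b) = suc (#inner a + #inner b)

  deepEdges : Tree n → ℕ
  deepEdges (leaf _)   = 0
  deepEdges (node a b) = 2 * #inner a + 2 * #inner b

  edges-node : ∀ x y → suc (2 * x) + suc (2 * y) ≡ 2 * suc (x + y)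
  edges-node = solve-∀

  mutual
    length-graftings : (R S : Tree n) → length (graftings R S) ≡ suc (2 * #inner R)
    length-graftings R S = cong suc (length-innerGraftings R S)

    length-innerGraftings : (R S : Tree n) → length (innerGraftings R S) ≡ 2 * #inner R
    length-innerGraftings (leaf _)   S = refl
    length-innerGraftings (node a b) S = begin
      length (map (graftLeft b) (graftings a S) ++ map (graftRight a) (graftings b S))
        ≡⟨ length-++ (map (graftLeft b) (graftings a S)) ⟩
      length (map (graftLeft b) (graftings a S)) + length (map (graftRight a) (graftings b S))
        ≡⟨ cong₂ _+_ (trans (length-map _ (graftings a S)) (length-graftings a S))
                     (trans (length-map _ (graftings b S)) (length-graftings b S)) ⟩
      suc (2 * #inner a) + suc (2 * #inner b)
        ≡⟨ edges-node (#inner a) (#inner b) ⟩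
      2 * suc (#inner a + #inner b) ∎

  mutual
    length-prunings : (t : Tree n) → length (prunings t) ≡ 2 * #inner t
    length-prunings (leaf _)   = refl
    length-prunings (node a b) = trans (cong (suc ∘ suc) (length-deepPrunings a b)) (prunings-node (#inner a) (#inner b))
      where
      prunings-node : ∀ x y → suc (suc (2 * x + 2 * y)) ≡ 2 * suc (x + y)
      prunings-node = solve-∀

    length-deepPrunings : (a b : Tree n) → length (deepPrunings a b) ≡ 2 * #inner a + 2 * #inner b
    length-deepPrunings a b =
      trans (length-++ (map (pruneLeft b) (prunings a)))
            (cong₂ _+_ (trans (length-map _ (prunings a)) (length-prunings a))
                       (trans (length-map _ (prunings b)) (length-prunings b)))

  length-concat-map : {A B : Set} (f : A → List B) {k : ℕ} → (∀ x → length (f x) ≡ k) →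
                      (xs : List A) → length (concat (map f xs)) ≡ length xs * k
  length-concat-map f eq []       = refl
  length-concat-map f eq (x ∷ xs) = trans (length-++ (f x)) (cong₂ _+_ (eq x) (length-concat-map f eq xs))

  length-crossGrafts : (A B : Tree n) → length (crossGrafts A B) ≡ 2 * #inner A * suc (2 * #inner B)
  length-crossGrafts A B =
    trans (length-concat-map (regraftsInto B)
                             (λ (S , _ , _) → trans (length-map _ (graftings B S)) (length-graftings B S)) (prunings A))
          (cong (_* suc (2 * #inner B)) (length-prunings A))

  length-splitMoves : (A B : Tree n) → length (splitMoves A B) ≡ 2 * #inner A * suc (2 * #inner B) + 2 * deepEdges A
  length-splitMoves (leaf _)     B = refl
  length-splitMoves A@(node a₁ a₂) B = begin
    length (crossGrafts A B ++ rootGrafts a₁ a₂ B ++ sinkGrafts a₁ a₂ B)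
      ≡⟨ length-++ (crossGrafts A B) ⟩
    length (crossGrafts A B) + length (rootGrafts a₁ a₂ B ++ sinkGrafts a₁ a₂ B)
      ≡⟨ cong₂ _+_ (length-crossGrafts A B) (length-++ (rootGrafts a₁ a₂ B)) ⟩
    2 * #inner A * suc (2 * #inner B) + (length (rootGrafts a₁ a₂ B) + length (sinkGrafts a₁ a₂ B))
      ≡⟨ cong (2 * #inner A * suc (2 * #inner B) +_) (cong₂ _+_ length-root length-sink) ⟩
    2 * #inner A * suc (2 * #inner B) + (deepEdges A + deepEdges A)
      ≡⟨ cong (2 * #inner A * suc (2 * #inner B) +_) (double (deepEdges A)) ⟩
    2 * #inner A * suc (2 * #inner B) + 2 * deepEdges A ∎
    where
    length-root : length (rootGrafts a₁ a₂ B) ≡ deepEdges A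
    length-root = trans (length-map _ (deepPrunings a₁ a₂)) (length-deepPrunings a₁ a₂)
    length-sink : length (sinkGrafts a₁ a₂ B) ≡ deepEdges A
    length-sink = trans (length-++ (map (λ g → node (proj₁ g) a₂) (innerGraftings a₁ B)))
                        (cong₂ _+_ (trans (length-map _ (innerGraftings a₁ B)) (length-innerGraftings a₁ B))
                                   (trans (length-map _ (innerGraftings a₂ B)) (length-innerGraftings a₂ B)))
    double : ∀ x → x + x ≡ 2 * x
    double = solve-∀

  length-mirroredSplitMoves : (A B : Tree n) → length (mirroredSplitMoves A B) ≡ length (splitMoves B A)
  length-mirroredSplitMoves A B = Pointwise-length (mirroredSplitMoves≅splitMoves {A = A} {B = B})

  length-subtrees : (t : Tree n) → length (subtrees t) ≡ suc (2 * #inner t)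
  length-subtrees (leaf _)   = refl
  length-subtrees (node a b) =
    cong suc (trans (length-++ (subtrees a)) (trans (cong₂ _+_ (length-subtrees a) (length-subtrees b))
                                                    (edges-node (#inner a) (#inner b))))

  sumδ-node : (a b : Tree n) → sumδ (node a b) ≡ 2 * #inner (node a b) + (sumδ a + sumδ b)
  sumδ-node a b =
    cong₂ _+_ (cong (_∸ 1) (length-subtrees (node a b)))
              (trans (cong sum (map-++ δ (subtrees a) (subtrees b))) (sum-++ (map δ (subtrees a)) (map δ (subtrees b))))

  length-neighbours-node : (A B : Tree n) → length (neighbours (node A B)) ≡
    length (neighbours A) + (length (neighbours B) +
      ((2 * #inner A * suc (2 * #inner B) + 2 * deepEdges A) + (2 * #inner B * suc (2 * #inner A) + 2 * deepEdges B)))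
  length-neighbours-node A B = begin
    length (map (λ X → node X B) (neighbours A) ++ map (node A) (neighbours B) ++ splitMoves A B ++ mirroredSplitMoves A B)
      ≡⟨ length-++ (map (λ X → node X B) (neighbours A)) ⟩
    length (map (λ X → node X B) (neighbours A)) + length (map (node A) (neighbours B) ++ splitMoves A B ++ mirroredSplitMoves A B)
      ≡⟨ cong₂ _+_ (length-map _ (neighbours A)) (length-++ (map (node A) (neighbours B))) ⟩
    length (neighbours A) + (length (map (node A) (neighbours B)) + length (splitMoves A B ++ mirroredSplitMoves A B))
      ≡⟨ cong (length (neighbours A) +_) (cong₂ _+_ (length-map _ (neighbours B)) (length-++ (splitMoves A B))) ⟩
    length (neighbours A) + (length (neighbours B) + (length (splitMoves A B) + length (mirroredSplitMoves A B)))
      ≡⟨ cong (λ l → length (neighbours A) + (length (neighbours B) + l))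
              (cong₂ _+_ (length-splitMoves A B) (trans (length-mirroredSplitMoves A B) (length-splitMoves B A))) ⟩
    length (neighbours A) + (length (neighbours B) +
      ((2 * #inner A * suc (2 * #inner B) + 2 * deepEdges A) + (2 * #inner B * suc (2 * #inner A) + 2 * deepEdges B))) ∎

  neighbours-counted : (t : Tree n) →
    length (neighbours t) + sumδ t + 6 * #inner t + 2 * deepEdges t ≡ 4 * #inner t * #inner t + 4 * #inner t
  neighbours-counted (leaf _)   = refl
  neighbours-counted (node A B) = begin
    length (neighbours (node A B)) + sumδ (node A B) + 6 * #inner (node A B) + 2 * deepEdges (node A B)
      ≡⟨ cong₂ (λ l s → l + s + 6 * suc (mA + mB) + 2 * (2 * mA + 2 * mB)) (length-neighbours-node A B) (sumδ-node A B) ⟩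
    (lA + (lB + ((2 * mA * suc (2 * mB) + 2 * dA) + (2 * mB * suc (2 * mA) + 2 * dB)))) + (2 * suc (mA + mB) + (sA + sB))
      + 6 * suc (mA + mB) + 2 * (2 * mA + 2 * mB)
      ≡⟨ regroup lA lB sA sB mA mB dA dB ⟩
    (lA + sA + 6 * mA + 2 * dA) + (lB + sB + 6 * mB + 2 * dB) + (8 * mA * mB + 8 * mA + 8 * mB + 8)
      ≡⟨ cong₂ (λ x y → x + y + (8 * mA * mB + 8 * mA + 8 * mB + 8)) (neighbours-counted A) (neighbours-counted B) ⟩
    (4 * mA * mA + 4 * mA) + (4 * mB * mB + 4 * mB) + (8 * mA * mB + 8 * mA + 8 * mB + 8)
      ≡⟨ complete-square mA mB ⟩
    4 * suc (mA + mB) * suc (mA + mB) + 4 * suc (mA + mB) ∎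
    where
    mA = #inner A
    mB = #inner B
    lA = length (neighbours A)
    lB = length (neighbours B)
    sA = sumδ A
    sB = sumδ B
    dA = deepEdges A
    dB = deepEdges B
    regroup : ∀ lA lB sA sB a b dA dB →
      (lA + (lB + ((2 * a * suc (2 * b) + 2 * dA) + (2 * b * suc (2 * a) + 2 * dB)))) + (2 * suc (a + b) + (sA + sB))
        + 6 * suc (a + b) + 2 * (2 * a + 2 * b)
      ≡ (lA + sA + 6 * a + 2 * dA) + (lB + sB + 6 * b + 2 * dB) + (8 * a * b + 8 * a + 8 * b + 8)
    regroup = solve-∀
    complete-square : ∀ a b → (4 * a * a + 4 * a) + (4 * b * b + 4 * b) + (8 * a * b + 8 * a + 8 * b + 8)
                              ≡ 4 * suc (a + b) * suc (a + b) + 4 * suc (a + b)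
    complete-square = solve-∀

  neighbours-count-by-size : (A B : Tree n) → let k = suc (#inner (node A B)) in
    length (neighbours (node A B)) + sumδ (node A B) + 14 * k ≡ 4 * k * k + 14
  neighbours-count-by-size A B =
    shift (length (neighbours (node A B))) (sumδ (node A B)) (#inner A) (#inner B) (neighbours-counted (node A B))
    where
    shift : ∀ l s a b → l + s + 6 * suc (a + b) + 2 * (2 * a + 2 * b) ≡ 4 * suc (a + b) * suc (a + b) + 4 * suc (a + b) →
            l + s + 14 * suc (suc (a + b)) ≡ 4 * suc (suc (a + b)) * suc (suc (a + b)) + 14
    shift l s a b eq = +-cancelʳ-≡ (10 * (a + b) + 6) _ _ (begin
      l + s + 14 * suc (suc (a + b)) + (10 * (a + b) + 6)
        ≡⟨ left a b l s ⟩
      l + s + 6 * suc (a + b) + 2 * (2 * a + 2 * b) + 14 * suc (suc (a + b))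
        ≡⟨ cong (_+ 14 * suc (suc (a + b))) eq ⟩
      4 * suc (a + b) * suc (a + b) + 4 * suc (a + b) + 14 * suc (suc (a + b))
        ≡⟨ right a b ⟩
      4 * suc (suc (a + b)) * suc (suc (a + b)) + 14 + (10 * (a + b) + 6) ∎)
      where
      left : ∀ a b l s → l + s + 14 * suc (suc (a + b)) + (10 * (a + b) + 6)
                         ≡ l + s + 6 * suc (a + b) + 2 * (2 * a + 2 * b) + 14 * suc (suc (a + b))
      left = solve-∀
      right : ∀ a b → 4 * suc (a + b) * suc (a + b) + 4 * suc (a + b) + 14 * suc (suc (a + b))
                      ≡ 4 * suc (suc (a + b)) * suc (suc (a + b)) + 14 + (10 * (a + b) + 6)
      right = solve-∀

  ∈ₜ⇒∈leaves : x ∈ₜ t → x ∈ leaves t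
  ∈ₜ⇒∈leaves leaf∈                    = here refl
  ∈ₜ⇒∈leaves (left∈ m)                = ∈-++⁺ˡ (∈ₜ⇒∈leaves m)
  ∈ₜ⇒∈leaves {t = node a _} (right∈ m) = ∈-++⁺ʳ (leaves a) (∈ₜ⇒∈leaves m)

  unique⇒uniqueLeaves : Unique (leaves t) → UniqueLeaves t
  unique⇒uniqueLeaves {t = leaf _}   _ = _
  unique⇒uniqueLeaves {t = node a b} u with Unique-++⁻ (leaves a) u
  ... | ua , ub , dab = unique⇒uniqueLeaves ua , unique⇒uniqueLeaves ub , λ ma mb → dab (∈ₜ⇒∈leaves ma) (∈ₜ⇒∈leaves mb)

  isPhylo⇒uniqueLeaves : IsPhylo {n} t → UniqueLeaves t
  isPhylo⇒uniqueLeaves {n = n} phylo =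
    unique⇒uniqueLeaves (Unique-resp-↭ (setoid (Fin n)) (↭⇒↭ₛ (↭-sym phylo)) (allFin⁺ n))

  length-leaves : (t : Tree n) → length (leaves t) ≡ suc (#inner t)
  length-leaves (leaf _)   = refl
  length-leaves (node a b) =
    trans (length-++ (leaves a)) (trans (cong₂ _+_ (length-leaves a) (length-leaves b)) (cong suc (+-suc (#inner a) (#inner b))))

  isPhylo⇒#inner : IsPhylo {n} t → n ≡ suc (#inner t)
  isPhylo⇒#inner {n = n} {t = t} phylo =
    trans (sym (length-tabulate {n = n} (λ i → i))) (trans (sym (↭-length phylo)) (length-leaves t))


  neighbours-count : (A B : Tree n) → IsPhylo (node A B) →
                     length (neighbours (node A B)) + sumδ (node A B) + 14 * n ≡ 4 * n * n + 14
  neighbours-count A B phylo =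
    subst (λ k → length (neighbours (node A B)) + sumδ (node A B) + 14 * k ≡ 4 * k * k + 14)
          (sym (isPhylo⇒#inner {t = node A B} phylo)) (neighbours-count-by-size A B)

open Neighbourhood
open import Data.Nat as ℕ using (ℕ; _≤_; _*_)
open import Data.Nat.Properties using (1+n≰n)
open import Data.Integer using (+_; _+_; _-_)
open import Data.Integer.Properties using (pos-+)
open import Data.Integer.Tactic.RingSolver using (solve-∀)
open import Data.List using (List; length)
open import Data.List.Relation.Unary.All using (All)
open import Data.List.Relation.Unary.Any using (Any)
open import Data.List.Relation.Unary.AllPairs using (AllPairs)
open import Data.Product using (Σ; _×_; _,_)
open import Data.Empty using (⊥-elim)
open import Relation.Nullary using (¬_)
open import Relation.Binary.PropositionalEquality using (_≡_; sym; cong; subst; module ≡-Reasoning)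
open ≡-Reasoning

ℕ-identity⇒ℤ : ∀ l s k → l ℕ.+ s ℕ.+ 14 * k ≡ 4 * k * k ℕ.+ 14 → + l ≡ (+ (4 * k * k) - + (14 * k) + + 14) - + s
ℕ-identity⇒ℤ l s k eq = begin
  + l                                       ≡⟨ isolate (+ l) (+ s) (+ (14 * k)) ⟩
  ((+ l + + s) + + (14 * k)) - + (14 * k) - + s ≡⟨ cong (λ z → z - + (14 * k) - + s) lifted ⟩
  (+ (4 * k * k) + + 14) - + (14 * k) - + s ≡⟨ rearrange (+ (4 * k * k)) (+ (14 * k)) (+ s) ⟩
  (+ (4 * k * k) - + (14 * k) + + 14) - + s ∎
  where
  lifted : (+ l + + s) + + (14 * k) ≡ + (4 * k * k) + + 14
  lifted = begin
    (+ l + + s) + + (14 * k) ≡⟨ cong (_+ + (14 * k)) (sym (pos-+ l s)) ⟩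
    + (l ℕ.+ s) + + (14 * k) ≡⟨ sym (pos-+ (l ℕ.+ s) (14 * k)) ⟩
    + (l ℕ.+ s ℕ.+ 14 * k)   ≡⟨ cong +_ eq ⟩
    + (4 * k * k ℕ.+ 14)     ≡⟨ pos-+ (4 * k * k) 14 ⟩
    + (4 * k * k) + + 14     ∎
  isolate : ∀ l s q → l ≡ ((l + s) + q) - q - s
  isolate = solve-∀
  rearrange : ∀ p q s → (p + + 14) - q - s ≡ (p - q + + 14) - s
  rearrange = solve-∀

corollary9 : (n : ℕ) → 2 ≤ n → (T : Tree n) → IsPhylo T →
  Σ (List (Tree n)) λ L →
    All (λ T' → SNPR T T' × ¬ (T' ≅ T)) L
    × (∀ T' → SNPR T T' → ¬ (T' ≅ T) → Any (λ T'' → T' ≅ T'') L)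
    × AllPairs (λ T₁ T₂ → ¬ (T₁ ≅ T₂)) L
    × (+ length L ≡ (+ (4 * n * n) - + (14 * n) + + 14) - + sumδ T)
corollary9 n 2≤n (leaf _)   phylo = ⊥-elim (1+n≰n (subst (2 ≤_) (isPhylo⇒#inner phylo) 2≤n))
corollary9 n 2≤n (node A B) phylo =
  neighbours (node A B) , neighbours-sound unique , neighbours-complete (node A B) , neighbours-distinct unique ,
  ℕ-identity⇒ℤ (length (neighbours (node A B))) (sumδ (node A B)) n (neighbours-count A B phylo)
  where
  unique = isPhylo⇒uniqueLeaves phylo
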